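{- Let $k$ be an integer and let $H$ be a graph with $\chi(H)\ge (k-1)^2+1$. If $G$ is an $(\le 1)$-subdivision of $H$, then there exists an induced subgraph $G'$ of $G$ such that either $\chi(G')\ge k$, or $G'$ is a $1$-subdivision of a graph $H'$ with $\chi(H')\ge k$.
   Context: All graphs are finite and simple; $\chi$ denotes chromatic number. An $(\le 1)$-subdivision of $H$ is a graph obtained from $H$ by subdividing each edge $e$ of $H$ $s_e$ times for some $s_e\in\{0,1\}$. The $1$-subdivision of $H$ is obtained by subdividing every edge of $H$ exactly once. -}

module Defs where

open import Data.Nat using (ℕ; _≤_)
open import Data.Fin using (Fin) renaming (_<_ to _<ᶠ_)
open import Data.Bool using (Bool; true; false)
open import Data.Product using (Σ; _×_; _,_; ∃)
open import Data.Sum using (_⊎_; inj₁; inj₂)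
open import Data.Empty using (⊥)
open import Function using (_∘_)
open import Function.Bundles using (_↔_; _⇔_; Inverse)
open import Relation.Binary.PropositionalEquality using (_≡_; _≢_)

record Graph : Set where
  field
    n     : ℕ
    adj   : Fin n → Fin n → Bool
    sym   : ∀ x y → adj x y ≡ adj y x
    irref : ∀ x → adj x x ≡ false
open Graph public

Adj : (G : Graph) → Fin (n G) → Fin (n G) → Set
Adj G x y = adj G x y ≡ true

Colouring : Graph → ℕ → Set
Colouring G j = Σ (Fin (n G) → Fin j) λ c → ∀ x y → Adj G x y → c x ≢ c y

ChiAtLeast : Graph → ℕ → Set
ChiAtLeast G m = ∀ j → Colouring G j → m ≤ j

IsInducedSubgraph : Graph → Graph → Set
IsInducedSubgraph G' G =
  Σ (Fin (n G') → Fin (n G)) λ f →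
    (∀ x y → f x ≡ f y → x ≡ y) ×
    (∀ x y → adj G' x y ≡ adj G (f x) (f y))

-- Subdivision of H according to a (symmetric) choice s : for an edge uv of H,
-- s u v = true means uv is subdivided once, false means it is kept.
-- Vertices: branch vertices (Fin n) plus one new vertex per subdivided edge,
-- the edge {u,v} being represented by its ordered pair with u < v.
SubVertex : (H : Graph) → (Fin (n H) → Fin (n H) → Bool) → Set
SubVertex H s =
  Fin (n H) ⊎
  Σ (Fin (n H) × Fin (n H)) λ { (u , v) → u <ᶠ v × Adj H u v × s u v ≡ true }

SubAdj : (H : Graph) (s : Fin (n H) → Fin (n H) → Bool) →
         SubVertex H s → SubVertex H s → Set
SubAdj H s (inj₁ x) (inj₁ y) = Adj H x y × s x y ≡ false
SubAdj H s (inj₁ x) (inj₂ ((u , v) , _)) = x ≡ u ⊎ x ≡ v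
SubAdj H s (inj₂ ((u , v) , _)) (inj₁ y) = y ≡ u ⊎ y ≡ v
SubAdj H s (inj₂ _) (inj₂ _) = ⊥

IsSubdivisionBy : (G H : Graph) → (Fin (n H) → Fin (n H) → Bool) → Set
IsSubdivisionBy G H s =
  Σ (Fin (n G) ↔ SubVertex H s) λ φ →
    ∀ x y → Adj G x y ⇔ SubAdj H s (Inverse.to φ x) (Inverse.to φ y)

IsLeq1Subdivision : Graph → Graph → Set
IsLeq1Subdivision G H =
  Σ (Fin (n H) → Fin (n H) → Bool) λ s →
    (∀ u v → s u v ≡ s v u) × IsSubdivisionBy G H s

IsOneSubdivision : Graph → Graph → Set
IsOneSubdivision G H = IsSubdivisionBy G H (λ _ _ → true)

{-# OPTIONS --safe #-}
-- Write k = m + 1.  If χ(G) ≤ m, fix a proper m-colouring c of G and let c₁ be its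
-- restriction to the branch vertices.  An edge of H that is not subdivided is an edge
-- of G, so every edge of H inside a colour class of c₁ is subdivided.  Were every colour
-- class m-colourable, H would be m²-colourable (colour u by the pair of c₁ u and its
-- colour inside its class), contradicting χ(H) ≥ m² + 1.  So some class H' has
-- χ(H') ≥ m + 1, and the branch vertices of H' together with the subdivision vertices
-- of the edges of H' induce the 1-subdivision of H' in G.
module Submission where

open import Defs hiding (sym)
open import Axiom.UniquenessOfIdentityProofs using (module Decidable⇒UIP)
open import Data.Bool using (Bool; true; false; T; _∧_)
open import Data.Bool.Properties using (T-∧; T-irrelevant) renaming (_≟_ to _≟ᵇ_)
open import Data.Empty using (⊥-elim)
open import Data.Fin using (Fin; zero; suc; combine; inject≤; _≟_) renaming (_<_ to _<ᶠ_)
open import Data.Fin.Properties using (all?; any?; ¬∀⟶∃¬; <-cmp; <-irrefl; <-asym; combine-injective; inject≤-injective)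
  renaming (<-irrelevant to <ᶠ-irrelevant)
open import Data.Nat using (ℕ; zero; suc; _∸_; _^_; _+_; _*_; _≤_; z≤n; z<s; s<s; _≤?_)
open import Data.Nat.Properties using (≰⇒>; *-identityʳ; m+1+n≰m)
open import Data.Product using (Σ; _×_; _,_; proj₁; proj₂)
open import Data.Sum using (_⊎_; inj₁; inj₂) renaming (map to map⊎)
open import Data.Vec.Functional using (_∷_; head; tail)
open import Function using (_∘_)
open import Function.Bundles using (_↔_; _⇔_; Inverse; Equivalence; mk↔ₛ′; mk⇔)
open import Function.Properties.Equivalence using () renaming (trans to ⇔-trans)
open import Relation.Binary using (tri<; tri≈; tri>)
open import Relation.Binary.PropositionalEquality
open import Relation.Nullary using (Dec; yes; no; ¬_)
open import Relation.Nullary.Decidable using (⌊_⌋; _→-dec_; ¬?; toWitness; fromWitness)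

open Decidable⇒UIP _≟ᵇ_ using () renaming (≡-irrelevant to ≡ᵇ-irrelevant)

record Enumeration {N : ℕ} (P : Fin N → Bool) : Set where
  field
    size       : ℕ
    elem       : Fin size → Fin N
    elem-∈     : ∀ a → T (P (elem a))
    index      : ∀ x → T (P x) → Fin size
    elem-index : ∀ x x∈ → elem (index x x∈) ≡ x
    index-elem : ∀ a x∈ → index (elem a) x∈ ≡ a
    elem-mono  : ∀ {a b} → a <ᶠ b → elem a <ᶠ elem b

  index-cong : ∀ {x y x∈ y∈} → x ≡ y → index x x∈ ≡ index y y∈
  index-cong {x∈ = x∈} {y∈} refl = cong (index _) (T-irrelevant x∈ y∈)

  index-injective : ∀ {x y x∈ y∈} → index x x∈ ≡ index y y∈ → x ≡ y
  index-injective {x} {y} {x∈} {y∈} eq =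
    trans (sym (elem-index x x∈)) (trans (cong elem eq) (elem-index y y∈))

  elem-injective : ∀ {a b} → elem a ≡ elem b → a ≡ b
  elem-injective {a} {b} eq =
    trans (sym (index-elem a (elem-∈ a))) (trans (index-cong eq) (index-elem b (elem-∈ b)))

  index-mono : ∀ {x y x∈ y∈} → x <ᶠ y → index x x∈ <ᶠ index y y∈
  index-mono {x} {y} {x∈} {y∈} x<y with <-cmp (index x x∈) (index y y∈)
  ... | tri< i<j _ _ = i<j
  ... | tri≈ _ i≡j _ = ⊥-elim (<-irrefl (index-injective i≡j) x<y)
  ... | tri> _ _ j<i =
    ⊥-elim (<-asym x<y (subst₂ _<ᶠ_ (elem-index y y∈) (elem-index x x∈) (elem-mono j<i)))

module _ {N : ℕ} {P : Fin (suc N) → Bool} where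

  enumeration-keep-zero : P zero ≡ true → Enumeration (P ∘ suc) → Enumeration P
  enumeration-keep-zero P₀ E = record
    { size = suc size ; elem = elem′ ; elem-∈ = elem-∈′ ; index = index′
    ; elem-index = elem-index′ ; index-elem = index-elem′ ; elem-mono = elem-mono′ }
    where
    open Enumeration E
    elem′ : Fin (suc size) → Fin (suc N)
    elem′ zero    = zero
    elem′ (suc a) = suc (elem a)
    elem-∈′ : ∀ a → T (P (elem′ a))
    elem-∈′ zero    = subst T (sym P₀) _
    elem-∈′ (suc a) = elem-∈ a
    index′ : ∀ x → T (P x) → Fin (suc size)
    index′ zero    _  = zero
    index′ (suc x) x∈ = suc (index x x∈)
    elem-index′ : ∀ x x∈ → elem′ (index′ x x∈) ≡ x
    elem-index′ zero    _  = refl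
    elem-index′ (suc x) x∈ = cong suc (elem-index x x∈)
    index-elem′ : ∀ a x∈ → index′ (elem′ a) x∈ ≡ a
    index-elem′ zero    _  = refl
    index-elem′ (suc a) x∈ = cong suc (index-elem a x∈)
    elem-mono′ : ∀ {a b} → a <ᶠ b → elem′ a <ᶠ elem′ b
    elem-mono′ {zero}  {suc b} _         = z<s
    elem-mono′ {suc a} {suc b} (s<s a<b) = s<s (elem-mono a<b)

  enumeration-skip-zero : P zero ≡ false → Enumeration (P ∘ suc) → Enumeration P
  enumeration-skip-zero P₀ E = record
    { size = size ; elem = suc ∘ elem ; elem-∈ = elem-∈ ; index = index′
    ; elem-index = elem-index′ ; index-elem = index-elem ; elem-mono = s<s ∘ elem-mono }
    where
    open Enumeration E
    index′ : ∀ x → T (P x) → Fin size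
    index′ zero    x∈ = ⊥-elim (subst T P₀ x∈)
    index′ (suc x) x∈ = index x x∈
    elem-index′ : ∀ x x∈ → suc (elem (index′ x x∈)) ≡ x
    elem-index′ zero    x∈ = ⊥-elim (subst T P₀ x∈)
    elem-index′ (suc x) x∈ = cong suc (elem-index x x∈)

enumerate : ∀ {N} (P : Fin N → Bool) → Enumeration P
enumerate {zero} P = record
  { size = 0 ; elem = λ () ; elem-∈ = λ () ; index = λ () ; elem-index = λ ()
  ; index-elem = λ () ; elem-mono = λ { {()} } }
enumerate {suc N} P with P zero in P₀
... | true  = enumeration-keep-zero P₀ (enumerate (P ∘ suc))
... | false = enumeration-skip-zero P₀ (enumerate (P ∘ suc))

induced : (G : Graph) → (Fin (n G) → Bool) → Graph
induced G P = record
  { n = size ; adj = λ a b → adj G (elem a) (elem b)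
  ; sym = λ _ _ → Graph.sym G _ _ ; irref = λ _ → irref G _ }
  where open Enumeration (enumerate P)

module _ (G : Graph) (P : Fin (n G) → Bool) where
  open Enumeration (enumerate P)

  induced-isInducedSubgraph : IsInducedSubgraph (induced G P) G
  induced-isInducedSubgraph = elem , (λ _ _ → elem-injective) , λ _ _ → refl

  induced-adj : ∀ {x y} x∈ y∈ → Adj G x y → Adj (induced G P) (index x x∈) (index y y∈)
  induced-adj x∈ y∈ = subst₂ (Adj G) (sym (elem-index _ x∈)) (sym (elem-index _ y∈))

isInducedSubgraph-refl : (G : Graph) → IsInducedSubgraph G G
isInducedSubgraph-refl G = (λ x → x) , (λ _ _ eq → eq) , λ _ _ → refl

∃-function? : ∀ N m (P : (Fin N → Fin m) → Set) →
  (∀ {c c′} → (∀ x → c x ≡ c′ x) → P c → P c′) → (∀ c → Dec (P c)) → Dec (Σ _ P)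
∃-function? zero m P resp P? with P? (λ ())
... | yes p  = yes (_ , p)
... | no ¬p  = no λ (c , p) → ¬p (resp (λ ()) p)
∃-function? (suc N) m P resp P?
  with any? (λ a → ∃-function? N m (P ∘ (a ∷_))
                     (λ eq → resp λ { zero → refl ; (suc x) → eq x }) (P? ∘ (a ∷_)))
... | yes (a , c , p) = yes (a ∷ c , p)
... | no ¬p = no λ (c , p) → ¬p (head c , tail c , resp (λ { zero → refl ; (suc x) → refl }) p)

colourable? : ∀ G j → Dec (Colouring G j)
colourable? G j = ∃-function? (n G) j _
  (λ c≗c′ proper x y xy eq → proper x y xy (trans (c≗c′ x) (trans eq (sym (c≗c′ y)))))
  (λ c → all? λ x → all? λ y → (adj G x y ≟ᵇ true) →-dec ¬? (c x ≟ c y))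

uncolourable⇒ChiAtLeast : ∀ G m → ¬ Colouring G m → ChiAtLeast G (suc m)
uncolourable⇒ChiAtLeast G m ¬col j (c , proper) with j ≤? m
... | yes j≤m = ⊥-elim (¬col ((λ x → inject≤ (c x) j≤m) ,
                              λ x y xy eq → proper x y xy (inject≤-injective _ _ _ _ eq)))
... | no j≰m  = ≰⇒> j≰m

fibre : ∀ {a} (G : Graph) → (Fin (n G) → Fin a) → Fin a → Graph
fibre G f i = induced G λ x → ⌊ f x ≟ i ⌋

colouring-from-fibres : ∀ {a b} (G : Graph) (f : Fin (n G) → Fin a) →
  (∀ i → Colouring (fibre G f i) b) → Colouring G (a * b)
colouring-from-fibres G f colᵢ = c , proper
  where
  module E i = Enumeration (enumerate λ x → ⌊ f x ≟ i ⌋)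

  in-own-fibre : ∀ x → T ⌊ f x ≟ f x ⌋
  in-own-fibre x = fromWitness refl

  colour-in-fibre : ∀ i x → T ⌊ f x ≟ i ⌋ → Fin _
  colour-in-fibre i x x∈ = proj₁ (colᵢ i) (E.index i x x∈)

  c : Fin (n G) → Fin _
  c x = combine (f x) (colour-in-fibre (f x) x (in-own-fibre x))

  fibre-proper : ∀ {i j} → i ≡ j → ∀ x y x∈ y∈ →
    colour-in-fibre i x x∈ ≡ colour-in-fibre j y y∈ → ¬ Adj G x y
  fibre-proper {i} refl x y x∈ y∈ eq xy = proj₂ (colᵢ i) _ _ (induced-adj G _ x∈ y∈ xy) eq

  proper : ∀ x y → Adj G x y → c x ≢ c y
  proper x y xy cx≡cy =
    let fx≡fy , same = combine-injective (f x) _ (f y) _ cx≡cy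
    in fibre-proper fx≡fy x y _ _ same xy

uncolourable-fibre : ∀ {a b} (G : Graph) (f : Fin (n G) → Fin a) →
  ¬ Colouring G (a * b) → Σ (Fin a) λ i → ¬ Colouring (fibre G f i) b
uncolourable-fibre {a} {b} G f ¬col with all? (λ i → colourable? (fibre G f i) b)
... | yes colᵢ = ⊥-elim (¬col (colouring-from-fibres G f colᵢ))
... | no ¬colᵢ = ¬∀⟶∃¬ a _ (λ i → colourable? (fibre G f i) b) ¬colᵢ

subdivision-vertex-≡ : ∀ {K : Graph} {t} {u v u′ v′ : Fin (n K)} {uv uv′} → u ≡ u′ → v ≡ v′ →
  _≡_ {A = SubVertex K t} (inj₂ ((u , v) , uv)) (inj₂ ((u′ , v′) , uv′))
subdivision-vertex-≡ {uv = u<v , adj , sub} {u<v′ , adj′ , sub′} refl refl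
  rewrite <ᶠ-irrelevant u<v u<v′ | ≡ᵇ-irrelevant adj adj′ | ≡ᵇ-irrelevant sub sub′ = refl

module _ (G H : Graph) {s : Fin (n H) → Fin (n H) → Bool} (sub : IsSubdivisionBy G H s) where
  open Inverse (proj₁ sub)

  branch-colouring : ∀ {j} → Colouring G j → Fin (n H) → Fin j
  branch-colouring (c , _) u = c (from (inj₁ u))

  monochromatic-edge-subdivided : ∀ {j} (col : Colouring G j) {u v} →
    branch-colouring col u ≡ branch-colouring col v → Adj H u v → s u v ≡ true
  monochromatic-edge-subdivided (c , proper) {u} {v} same uv with s u v in suv
  ... | true  = refl
  ... | false = ⊥-elim (proper _ _ (Equivalence.from (proj₂ sub _ _) branch-edge) same)
    where
    branch-edge : SubAdj H s (to (from (inj₁ u))) (to (from (inj₁ v)))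
    branch-edge = subst₂ (SubAdj H s) (sym (strictlyInverseˡ _)) (sym (strictlyInverseˡ _)) (uv , suv)

  module _ (P : Fin (n H) → Bool)
           (subdivided : ∀ {u v} → T (P u) → T (P v) → Adj H u v → s u v ≡ true) where
    private
      module V = Enumeration (enumerate P)

      H′ : Graph
      H′ = induced H P

      lies-over : SubVertex H s → Bool
      lies-over (inj₁ u)             = P u
      lies-over (inj₂ ((u , v) , _)) = P u ∧ P v

      lift : ∀ w → T (lies-over w) → SubVertex H′ (λ _ _ → true)
      lift (inj₁ u) u∈ = inj₁ (V.index u u∈)
      lift (inj₂ ((u , v) , u<v , uv , _)) uv∈ =
        let u∈ , v∈ = Equivalence.to T-∧ uv∈
        in inj₂ ((V.index u u∈ , V.index v v∈) , V.index-mono u<v , induced-adj H P u∈ v∈ uv , refl)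

      lower : SubVertex H′ (λ _ _ → true) → SubVertex H s
      lower (inj₁ a) = inj₁ (V.elem a)
      lower (inj₂ ((a , b) , a<b , ab , _)) =
        inj₂ ((V.elem a , V.elem b) , V.elem-mono a<b , ab , subdivided (V.elem-∈ a) (V.elem-∈ b) ab)

      lower-lies-over : ∀ y → T (lies-over (lower y))
      lower-lies-over (inj₁ a)             = V.elem-∈ a
      lower-lies-over (inj₂ ((a , b) , _)) = Equivalence.from T-∧ (V.elem-∈ a , V.elem-∈ b)

      lift-cong : ∀ {w w′ w∈ w′∈} → w ≡ w′ → lift w w∈ ≡ lift w′ w′∈
      lift-cong {w∈ = w∈} {w′∈} refl = cong (lift _) (T-irrelevant w∈ w′∈)

      lift-lower : ∀ y y∈ → lift (lower y) y∈ ≡ y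
      lift-lower (inj₁ a) _              = cong inj₁ (V.index-elem a _)
      lift-lower (inj₂ ((a , b) , _)) _ = subdivision-vertex-≡ {K = H′} (V.index-elem a _) (V.index-elem b _)

      lower-lift : ∀ w w∈ → lower (lift w w∈) ≡ w
      lower-lift (inj₁ u) _              = cong inj₁ (V.elem-index u _)
      lower-lift (inj₂ ((u , v) , _)) _ = subdivision-vertex-≡ {K = H} (V.elem-index u _) (V.elem-index v _)

      lift-adj : ∀ w w′ w∈ w′∈ → SubAdj H s w w′ ⇔ SubAdj H′ (λ _ _ → true) (lift w w∈) (lift w′ w′∈)
      lift-adj (inj₁ u) (inj₁ v) u∈ v∈ =
        mk⇔ (λ (uv , kept) → ⊥-elim (subst T (trans (sym (subdivided u∈ v∈ uv)) kept) _)) λ ()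
      lift-adj (inj₁ _) (inj₂ _) _ _ =
        mk⇔ (map⊎ V.index-cong V.index-cong) (map⊎ V.index-injective V.index-injective)
      lift-adj (inj₂ _) (inj₁ _) _ _ =
        mk⇔ (map⊎ V.index-cong V.index-cong) (map⊎ V.index-injective V.index-injective)
      lift-adj (inj₂ _) (inj₂ _) _ _ = mk⇔ (λ ()) (λ ())

      module W = Enumeration (enumerate (lies-over ∘ to))

      G′ : Graph
      G′ = induced G (lies-over ∘ to)

      ψ : Fin (n G′) ↔ SubVertex H′ (λ _ _ → true)
      ψ = mk↔ₛ′ ψ-to ψ-from ψ-to-from ψ-from-to
        where
        ψ-to : Fin (n G′) → SubVertex H′ (λ _ _ → true)
        ψ-to a = lift (to (W.elem a)) (W.elem-∈ a)

        from-lower-∈ : ∀ y → T (lies-over (to (from (lower y))))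
        from-lower-∈ y = subst (T ∘ lies-over) (sym (strictlyInverseˡ (lower y))) (lower-lies-over y)

        ψ-from : SubVertex H′ (λ _ _ → true) → Fin (n G′)
        ψ-from y = W.index (from (lower y)) (from-lower-∈ y)

        ψ-to-from : ∀ y → ψ-to (ψ-from y) ≡ y
        ψ-to-from y = trans (lift-cong {w∈ = W.elem-∈ (ψ-from y)} {lower-lies-over y}
                              (trans (cong to (W.elem-index _ _)) (strictlyInverseˡ _)))
                            (lift-lower y _)

        ψ-from-to : ∀ a → ψ-from (ψ-to a) ≡ a
        ψ-from-to a = trans (W.index-cong {y∈ = W.elem-∈ a}
                              (trans (cong from (lower-lift _ _)) (strictlyInverseʳ _)))
                            (W.index-elem a _)

    restricted-subdivision : Σ Graph λ G′ → IsInducedSubgraph G′ G × IsOneSubdivision G′ (induced H P)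
    restricted-subdivision = G′ , induced-isInducedSubgraph G (lies-over ∘ to) ,
      ψ , λ a b → ⇔-trans (proj₂ sub (W.elem a) (W.elem b)) (lift-adj _ _ (W.elem-∈ a) (W.elem-∈ b))

  fibre-subdivision : ∀ {j} (col : Colouring G j) i →
    Σ Graph λ G′ → IsInducedSubgraph G′ G × IsOneSubdivision G′ (fibre H (branch-colouring col) i)
  fibre-subdivision col i = restricted-subdivision (λ u → ⌊ branch-colouring col u ≟ i ⌋)
    λ u∈ v∈ → monochromatic-edge-subdivided col (trans (toWitness u∈) (sym (toWitness v∈)))

proposition6p5 : (k : ℕ) (H G : Graph) →
    ChiAtLeast H ((k ∸ 1) ^ 2 + 1) →
    IsLeq1Subdivision G H →
    Σ Graph λ G' → IsInducedSubgraph G' G ×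
      (ChiAtLeast G' k ⊎
       Σ Graph λ H' → IsOneSubdivision G' H' × ChiAtLeast H' k)
proposition6p5 zero H G _ _ = G , isInducedSubgraph-refl G , inj₁ λ _ _ → z≤n
proposition6p5 (suc m) H G χH (_ , _ , sub) with colourable? G m
... | no ¬col = G , isInducedSubgraph-refl G , inj₁ (uncolourable⇒ChiAtLeast G m ¬col)
... | yes col =
  let c₁ = branch-colouring G H sub col
      i , ¬colᵢ = uncolourable-fibre H c₁ H-not-m²-colourable
      G′ , G′⊆G , G′-sub = fibre-subdivision G H sub col i
  in G′ , G′⊆G , inj₂ (fibre H c₁ i , G′-sub , uncolourable⇒ChiAtLeast (fibre H c₁ i) m ¬colᵢ)
  where
  H-not-m²-colourable : ¬ Colouring H (m * m)
  H-not-m²-colourable col = m+1+n≰m (m * m) (subst (λ t → m * t + 1 ≤ m * m) (*-identityʳ m) (χH _ col))
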